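{- Let $G$ be a graph with $e > 0$ edges, where $3 \mid e$. Suppose there exist $G$ designs of order $e+1$ and $2e+1$, and suppose there exist decompositions into $G$ of the complete tripartite graph $K_{e,e,e}$ and of the complete 4-partite graph $K_{e/3,e/3,e/3,e/3}$. Then there exists a $G$ design of order $n$ for every $n \equiv 1 \pmod{e}$.
   Context: All graphs are simple. A decomposition of a graph $K$ into $G$ is a partition of the edge set of $K$ into edge sets of subgraphs each isomorphic to $G$; a $G$ design of order $n$ is a decomposition of the complete graph $K_n$ into $G$. By convention the empty set is a $G$ design of order $1$. -}

module Defs where

open import Data.Nat using (ℕ; zero; suc; _+_; _*_; _<ᵇ_; _≡ᵇ_)
open import Data.Nat.DivMod using (_%_)
open import Data.Fin using (Fin; toℕ)
open import Data.Bool using (Bool; true; false; not; _∧_; if_then_else_)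
open import Data.List using (List; map; allFin)
open import Data.Nat.ListAction using (sum)
open import Data.Product using (Σ; _×_; _,_; ∃)
open import Relation.Binary.PropositionalEquality using (_≡_)
open import Function.Definitions using (Injective)

record Graph : Set where
  field
    V      : ℕ
    Adj    : Fin V → Fin V → Bool
    sym    : ∀ x y → Adj x y ≡ Adj y x
    irrefl : ∀ x → Adj x x ≡ false
open Graph public

edges : Graph → ℕ
edges G = sum (map (λ x → sum (map (λ y →
            if (toℕ x <ᵇ toℕ y) ∧ Adj G x y then 1 else 0)
          (allFin (V G)))) (allFin (V G)))

K : ℕ → Graph
K n = record
  { V = n
  ; Adj = λ x y → not (toℕ x ≡ᵇ toℕ y)
  ; sym = λ x y → symℕ (toℕ x) (toℕ y)
  ; irrefl = λ x → irrℕ (toℕ x)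
  }
  where
  symℕ : ∀ a b → not (a ≡ᵇ b) ≡ not (b ≡ᵇ a)
  symℕ zero zero = _≡_.refl
  symℕ zero (suc b) = _≡_.refl
  symℕ (suc a) zero = _≡_.refl
  symℕ (suc a) (suc b) = symℕ a b
  irrℕ : ∀ a → not (a ≡ᵇ a) ≡ false
  irrℕ zero = _≡_.refl
  irrℕ (suc a) = irrℕ a

-- Complete (suc r)-partite graph with all parts of size m:
-- vertex set Fin ((suc r) * m), vertex x lies in part (toℕ x mod (suc r));
-- each part thus has exactly m vertices, and two vertices are adjacent
-- iff they lie in different parts.
Kmulti : ℕ → ℕ → Graph
Kmulti r m = record
  { V = suc r * m
  ; Adj = λ x y → not ((toℕ x % suc r) ≡ᵇ (toℕ y % suc r))
  ; sym = λ x y → symℕ (toℕ x % suc r) (toℕ y % suc r)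
  ; irrefl = λ x → irrℕ (toℕ x % suc r)
  }
  where
  symℕ : ∀ a b → not (a ≡ᵇ b) ≡ not (b ≡ᵇ a)
  symℕ zero zero = _≡_.refl
  symℕ zero (suc b) = _≡_.refl
  symℕ (suc a) zero = _≡_.refl
  symℕ (suc a) (suc b) = symℕ a b
  irrℕ : ∀ a → not (a ≡ᵇ a) ≡ false
  irrℕ zero = _≡_.refl
  irrℕ (suc a) = irrℕ a

K3part : ℕ → Graph
K3part m = Kmulti 2 m

K4part : ℕ → Graph
K4part m = Kmulti 3 m

record Copy (G H : Graph) : Set where
  field
    φ     : Fin (V G) → Fin (V H)
    inj   : Injective _≡_ _≡_ φ
    edge  : ∀ x y → Adj G x y ≡ true → Adj H (φ x) (φ y) ≡ true
open Copy public

Covers : {G H : Graph} {k : ℕ} → (Fin k → Copy G H) →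
         Fin (V H) → Fin (V H) → Set
Covers {G} {H} {k} c u v =
  Σ (Fin k) λ i → Σ (Fin (V G)) λ x → Σ (Fin (V G)) λ y →
    (Adj G x y ≡ true) × (φ (c i) x ≡ u) × (φ (c i) y ≡ v)

-- A decomposition of H into G: a finite family of copies of G in H whose
-- edge sets partition the edge set of H, i.e. every edge {u,v} of H is the
-- image of exactly one edge of exactly one copy.
record Decomposition (H G : Graph) : Set where
  field
    k       : ℕ
    copies  : Fin k → Copy G H
    covered : ∀ u v → Adj H u v ≡ true → Covers copies u v
    unique  : ∀ u v → (p q : Covers copies u v) →
              (Σ.proj₁ p ≡ Σ.proj₁ q) ×
              (Σ.proj₁ (Σ.proj₂ p) ≡ Σ.proj₁ (Σ.proj₂ q)) ×
              (Σ.proj₁ (Σ.proj₂ (Σ.proj₂ p)) ≡ Σ.proj₁ (Σ.proj₂ (Σ.proj₂ q)))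

Design : Graph → ℕ → Set
Design G n = Decomposition (K n) G

-- Blow every point of a GDD on t points up to e points and add one point ∞: K_{te+1} splits
-- into designs of order ge + 1 on each group of size g (plus ∞) and copies of K_{k×e} on each
-- block of size k. K_{3×e} is given; K_{4×e} comes from K_{4×e/3} and an OA(4, 3). A TD(4, s)
-- with s odd (from the cyclic OA with rows (a, a + δ, 2a + δ, δ)) truncated in one group is a
-- GDD of type s³u¹, which yields order t = 3s + u from the smaller orders s and u; together with
-- explicit GDDs for t = 5, 6, 7, 8, 13, 14 this covers every t by strong induction.
module Submission where

open import Defs hiding (sym)
open import Data.Bool using (true; false; not)
open import Data.Empty using (⊥; ⊥-elim)
open import Data.Fin
  using (Fin; zero; suc; toℕ; cast; quotient; remainder; combine; punchOut; inject₁; fromℕ; _↑ˡ_; _↑ʳ_; splitAt)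
open import Data.Fin.Properties
  using (_≟_; +↔⊎; *↔×; 1↔⊤; toℕ-injective; toℕ-cast; cast-involutive; toℕ-combine; combine-remQuot;
         toℕ<n; toℕ-fromℕ<; any?; all?; punchOut-injective; injective⇒≤; inject₁-injective;
         fromℕ≢inject₁; ↑ˡ-injective; splitAt-↑ˡ; splitAt-↑ʳ)
open import Data.Nat using (ℕ; zero; suc; _+_; _*_; _∸_; _<_; _≤_; z≤n; s≤s; _≡ᵇ_)
open import Data.Nat.Divisibility using (_∣_; divides)
open import Data.Nat.DivMod
  using (_%_; _/_; _mod_; %-distribˡ-+; %-distribˡ-*; [m+kn]%n≡m%n; m<n⇒m%n≡m; m≡m%n+[m/n]*n; m%n<n; m*n/n≡m)
open import Data.Nat.Induction using (<-rec; <-Rec)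
open import Data.Nat.Properties
  using (≡ᵇ⇒≡; ≡⇒≡ᵇ; +-comm; +-assoc; *-comm; *-identityˡ; 1+n≰n; m+[n∸m]≡n; m≤m+n; m≤n+m; m<m+n;
         ≤-trans; <-≤-trans; ≤-<-trans; ≤-pred)
open import Data.Nat.Tactic.RingSolver using (solve-∀)
open import Data.Product using (Σ; ∃; _×_; _,_; proj₁; proj₂; map₁)
open import Data.Product.Algebra using (×-comm; ×-distribʳ-⊎)
open import Data.Product.Function.Dependent.Propositional using (Σ-↔)
open import Data.Product.Function.NonDependent.Propositional using (_×-↔_)
open import Data.Product.Properties using (,-injectiveˡ; ,-injectiveʳ)
import Data.Product.Properties as Product
open import Data.Sum using (_⊎_; inj₁; inj₂; map₂)
open import Data.Sum.Algebra using (⊎-comm)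
open import Data.Sum.Function.Propositional using (_⊎-↔_)
open import Data.Sum.Properties using (inj₁-injective; inj₂-injective)
import Data.Sum.Properties as Sum
open import Data.Unit using (⊤; tt)
open import Data.Vec using (Vec; lookup; _∷_; [])
open import Function using (_∘_; id; _on_)
open import Function.Bundles using (_↔_; Inverse; Injection; mk↔ₛ′)
open import Function.Definitions using (Injective)
open import Function.Properties.Inverse using (↔-refl; ↔-sym; ↔-trans; ↔⇒↣)
open import Level using (0ℓ)
open import Relation.Binary.Definitions using (DecidableEquality)
open import Relation.Binary.PropositionalEquality
  using (_≡_; _≢_; refl; sym; trans; cong; cong₂; subst; module ≡-Reasoning)
open import Relation.Nullary using (Dec; yes; no; ¬?)
open import Relation.Nullary.Decidable using (True; toWitness; _×-dec_; _→-dec_)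

open Inverse using (to; from; strictlyInverseˡ)

Finite : Set → Set
Finite A = ∃ λ k → Fin k ↔ A

finite-Fin : ∀ n → Finite (Fin n)
finite-Fin n = n , ↔-refl

finite-↔ : ∀ {A B} → Finite A → A ↔ B → Finite B
finite-↔ (k , e) f = k , ↔-trans e f

finite-⊎ : ∀ {A B} → Finite A → Finite B → Finite (A ⊎ B)
finite-⊎ (a , e) (b , f) = a + b , ↔-trans +↔⊎ (e ⊎-↔ f)

Σ-Fin-suc : ∀ {n} (F : Fin (suc n) → Set) → (F zero ⊎ Σ (Fin n) (F ∘ suc)) ↔ Σ (Fin (suc n)) F
Σ-Fin-suc F = mk↔ₛ′
  (λ { (inj₁ y) → zero , y ; (inj₂ (i , y)) → suc i , y })
  (λ { (zero , y) → inj₁ y ; (suc i , y) → inj₂ (i , y) })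
  (λ { (zero , y) → refl ; (suc i , y) → refl })
  (λ { (inj₁ y) → refl ; (inj₂ (i , y)) → refl })

finite-ΣFin : ∀ n (F : Fin n → Set) → (∀ i → Finite (F i)) → Finite (Σ (Fin n) F)
finite-ΣFin zero    F h = 0 , mk↔ₛ′ (λ ()) (λ ()) (λ ()) (λ ())
finite-ΣFin (suc n) F h =
  finite-↔ (finite-⊎ (h zero) (finite-ΣFin n (F ∘ suc) (h ∘ suc))) (Σ-Fin-suc F)

finite-Σ : ∀ {I} {F : I → Set} → Finite I → (∀ i → Finite (F i)) → Finite (Σ I F)
finite-Σ {F = F} (n , e) h = finite-↔ (finite-ΣFin n (F ∘ to e) (h ∘ to e)) (Σ-↔ e ↔-refl)

Edge : (G : Graph) → Fin (V G) → Fin (V G) → Set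
Edge G x y = Adj G x y ≡ true

Image : {J X : Set} {Y : J → Set} → (∀ j → Y j → Y j → Set) → (∀ j → Y j → X) → X → X → Set
Image {J} {Y = Y} S ψ u v = Σ J λ j → Σ (Y j) λ a → Σ (Y j) λ b → S j a b × ψ j a ≡ u × ψ j b ≡ v

EdgeDisjoint : {J X : Set} {Y : J → Set} → (∀ j → Y j → Y j → Set) → (∀ j → Y j → X) → Set
EdgeDisjoint {J} {Y = Y} S ψ = ∀ {j j′} {a b : Y j} {a′ b′ : Y j′} → S j a b → S j′ a′ b′ →
  ψ j a ≡ ψ j′ a′ → ψ j b ≡ ψ j′ b′ → j ≡ j′

record EdgePartition (J : Set) {X : Set} (Y : J → Set) (S : ∀ j → Y j → Y j → Set) (R : X → X → Set) : Set where
  field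
    finite    : Finite J
    ψ         : ∀ j → Y j → X
    injective : ∀ j → Injective _≡_ _≡_ (ψ j)
    preserves : ∀ j {a b} → S j a b → R (ψ j a) (ψ j b)
    covers    : ∀ {u v} → R u v → Image S ψ u v
    disjoint  : EdgeDisjoint S ψ

Decomp : Graph → (X : Set) → (X → X → Set) → Set₁
Decomp G X R = Σ Set λ I → EdgePartition I (λ _ → Fin (V G)) (λ _ → Edge G) R

glue : ∀ {G J X Y S} {R : X → X → Set} → EdgePartition J Y S R → (∀ j → Decomp G (Y j) (S j)) → Decomp G X R
glue {G} {J} {X} {Y} {S} {R} P D = Σ J (proj₁ ∘ D) , record
  { finite    = finite-Σ P.finite (EdgePartition.finite ∘ proj₂ ∘ D)
  ; ψ         = embed
  ; injective = λ { (j , i) → Q.injective j i ∘ P.injective j }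
  ; preserves = λ { (j , i) → P.preserves j ∘ Q.preserves j i }
  ; covers    = covers
  ; disjoint  = disjoint
  }
  where
  module P = EdgePartition P
  module Q (j : J) = EdgePartition (proj₂ (D j))
  embed : Σ J (proj₁ ∘ D) → Fin (V G) → X
  embed (j , i) = P.ψ j ∘ Q.ψ j i
  covers : ∀ {u v} → R u v → Image (λ _ → Edge G) embed u v
  covers r with P.covers r
  ... | j , a , b , s , refl , refl with Q.covers j s
  ...   | i , x , y , e , refl , refl = (j , i) , x , y , e , refl , refl
  disjoint : EdgeDisjoint (λ _ → Edge G) embed
  disjoint {j , i} {j′ , i′} e e′ p q with P.disjoint (Q.preserves j i e) (Q.preserves j′ i′ e′) p q
  ... | refl = cong (j ,_) (Q.disjoint j e e′ (P.injective j p) (P.injective j q))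

↔-injective : ∀ {A B : Set} (e : A ↔ B) → Injective _≡_ _≡_ (to e)
↔-injective e = Injection.injective (↔⇒↣ e)

transport : ∀ {G : Graph} {X X′ : Set} {R : X → X → Set} {R′ : X′ → X′ → Set} (e : X ↔ X′) →
  (∀ {u v} → R u v → R′ (to e u) (to e v)) → (∀ {u v} → R′ u v → R (from e u) (from e v)) →
  Decomp G X R → Decomp G X′ R′
transport {G} {X} {R = R} {R′} e R⇒R′ R′⇒R D = glue {G} single (λ _ → D)
  where
  single : EdgePartition ⊤ (λ _ → X) (λ _ → R) R′
  single = record
    { finite    = 1 , 1↔⊤
    ; ψ         = λ _ → to e
    ; injective = λ _ → ↔-injective e
    ; preserves = λ _ → R⇒R′
    ; covers    = λ {u} {v} r′ → tt , from e u , from e v , R′⇒R r′ , strictlyInverseˡ e u , strictlyInverseˡ e v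
    ; disjoint  = λ _ _ _ _ → refl
    }

decomposition⇒Decomp : ∀ {G H} → Decomposition H G → Decomp G (Fin (V H)) (Edge H)
decomposition⇒Decomp {G} {H} D = Fin k , record
  { finite    = finite-Fin k
  ; ψ         = φ ∘ copies
  ; injective = inj ∘ copies
  ; preserves = λ i {x} {y} → edge (copies i) x y
  ; covers    = covered _ _
  ; disjoint  = λ {i} {i′} {x} {y} {x′} {y′} e e′ p q →
      proj₁ (unique _ _ (i , x , y , e , refl , refl) (i′ , x′ , y′ , e′ , sym p , sym q))
  }
  where open Decomposition D

Decomp⇒decomposition : ∀ {G H} → Decomp G (Fin (V H)) (Edge H) → Decomposition H G
Decomp⇒decomposition {G} {H} (I , D) = record
  { k       = k
  ; copies  = copies
  ; covered = covered
  ; unique  = unique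
  }
  where
  open EdgePartition D
  k = proj₁ finite
  e = proj₂ finite
  copies : Fin k → Copy G H
  copies a = record { φ = ψ (to e a) ; inj = injective (to e a) ; edge = λ x y → preserves (to e a) }
  covered : ∀ u v → Edge H u v → Covers copies u v
  covered u v h with covers h
  ... | i , x , y , a , refl , refl =
    from e i , x , y , a , cong (λ j → ψ j x) (strictlyInverseˡ e i) , cong (λ j → ψ j y) (strictlyInverseˡ e i)
  unique : ∀ u v (p q : Covers copies u v) →
    (proj₁ p ≡ proj₁ q) × (proj₁ (proj₂ p) ≡ proj₁ (proj₂ q)) × (proj₁ (proj₂ (proj₂ p)) ≡ proj₁ (proj₂ (proj₂ q)))
  unique u v (a , x , y , h , refl , refl) (a′ , x′ , y′ , h′ , p , q)
    with ↔-injective e (disjoint h h′ (sym p) (sym q))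
  ... | refl = refl , injective (to e a) (sym p) , injective (to e a) (sym q)

not-≡ᵇ⇒≢ : ∀ m n → not (m ≡ᵇ n) ≡ true → m ≢ n
not-≡ᵇ⇒≢ m .m h refl with m ≡ᵇ m | ≡⇒≡ᵇ m m refl
not-≡ᵇ⇒≢ m .m () refl | true | _

≢⇒not-≡ᵇ : ∀ m n → m ≢ n → not (m ≡ᵇ n) ≡ true
≢⇒not-≡ᵇ m n m≢n with m ≡ᵇ n | ≡ᵇ⇒≡ m n
... | false | _  = refl
... | true  | eq = ⊥-elim (m≢n (eq tt))

Decomp-resp : ∀ {G X} {R R′ : X → X → Set} →
  (∀ {u v} → R u v → R′ u v) → (∀ {u v} → R′ u v → R u v) → Decomp G X R → Decomp G X R′
Decomp-resp {G} R⇒R′ R′⇒R = transport {G} ↔-refl R⇒R′ R′⇒R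

design⇒Decomp : ∀ {G n} → Design G n → Decomp G (Fin n) _≢_
design⇒Decomp {G} D = Decomp-resp {G}
  (λ {u} {v} h → not-≡ᵇ⇒≢ (toℕ u) (toℕ v) h ∘ cong toℕ)
  (λ {u} {v} u≢v → ≢⇒not-≡ᵇ (toℕ u) (toℕ v) (u≢v ∘ toℕ-injective))
  (decomposition⇒Decomp D)

Decomp⇒design : ∀ {G n} → Decomp G (Fin n) _≢_ → Design G n
Decomp⇒design {G} D = Decomp⇒decomposition (Decomp-resp {G}
  (λ {u} {v} u≢v → ≢⇒not-≡ᵇ (toℕ u) (toℕ v) (u≢v ∘ toℕ-injective))
  (λ {u} {v} h → not-≡ᵇ⇒≢ (toℕ u) (toℕ v) h ∘ cong toℕ)
  D)

cast↔ : ∀ {m n} → m ≡ n → Fin m ↔ Fin n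
cast↔ eq = mk↔ₛ′ (cast eq) (cast (sym eq)) (cast-involutive eq (sym eq)) (cast-involutive (sym eq) eq)

toℕ-remainder : ∀ {m} n (i : Fin (m * suc n)) → toℕ (remainder {m} (suc n) i) ≡ toℕ i % suc n
toℕ-remainder {m} n i = sym (begin
  toℕ i % suc n                       ≡⟨ cong (λ j → toℕ j % suc n) (sym (combine-remQuot {m} (suc n) i)) ⟩
  toℕ (combine q r) % suc n           ≡⟨ cong (_% suc n) (toℕ-combine q r) ⟩
  (suc n * toℕ q + toℕ r) % suc n     ≡⟨ cong (_% suc n) (+-comm (suc n * toℕ q) (toℕ r)) ⟩
  (toℕ r + suc n * toℕ q) % suc n     ≡⟨ cong (λ z → (toℕ r + z) % suc n) (*-comm (suc n) (toℕ q)) ⟩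
  (toℕ r + toℕ q * suc n) % suc n     ≡⟨ [m+kn]%n≡m%n (toℕ r) (toℕ q) (suc n) ⟩
  toℕ r % suc n                       ≡⟨ m<n⇒m%n≡m (toℕ<n r) ⟩
  toℕ r                               ∎)
  where
  open ≡-Reasoning
  q = quotient {m} (suc n) i
  r = remainder {m} (suc n) i

multipartite↔ : ∀ r m → Fin (suc r * m) ↔ (Fin (suc r) × Fin m)
multipartite↔ r m = ↔-trans (cast↔ (*-comm (suc r) m)) (↔-trans *↔× (×-comm (Fin m) (Fin (suc r))))

toℕ-part : ∀ r m x → toℕ (proj₁ (to (multipartite↔ r m) x)) ≡ toℕ x % suc r
toℕ-part r m x = trans (toℕ-remainder {m} r (cast (*-comm (suc r) m) x)) (cong (_% suc r) (toℕ-cast _ x))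

multipartite⇒Decomp : ∀ {G r m} → Decomposition (Kmulti r m) G → Decomp G (Fin (suc r) × Fin m) (_≢_ on proj₁)
multipartite⇒Decomp {G} {r} {m} D = transport {G} e
  (λ {u} {v} h p → not-≡ᵇ⇒≢ _ _ h (trans (sym (toℕ-part r m u)) (trans (cong toℕ p) (toℕ-part r m v))))
  (λ {u} {v} u≢v → ≢⇒not-≡ᵇ _ _ (λ p → u≢v (toℕ-injective (trans (part-from u) (trans p (sym (part-from v)))))))
  (decomposition⇒Decomp D)
  where
  e = multipartite↔ r m
  part-from : ∀ u → toℕ (proj₁ u) ≡ toℕ (from e u) % suc r
  part-from u = trans (cong (toℕ ∘ proj₁) (sym (strictlyInverseˡ e u))) (toℕ-part r m (from e u))

record GDD (U : Set) : Set₁ where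
  field
    ≡-dec           : DecidableEquality U
    Group           : Set
    groups-finite   : Finite Group
    Member          : Group → Set
    group           : (g : Group) → Member g → U
    group-injective : ∀ g → Injective _≡_ _≡_ (group g)
    Block           : Set
    blocks-finite   : Finite Block
    size            : Block → ℕ
    block           : (b : Block) → Fin (size b) → U
    block-injective : ∀ b → Injective _≡_ _≡_ (block b)
    grouped         : ∀ u → Σ Group λ g → Σ (Member g) λ w → group g w ≡ u
    joined          : ∀ {u v} → u ≢ v → Image (λ _ _ _ → ⊤) group u v ⊎ Image (λ _ → _≢_) block u v
    groups-disjoint : ∀ {g g′ w w′} → group g w ≡ group g′ w′ → g ≡ g′
    group-block-meet : ∀ {g b w w′ p q} → p ≢ q → group g w ≡ block b p → group g w′ ≡ block b q → ⊥
    blocks-disjoint : EdgeDisjoint (λ _ → _≢_) block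

map₁-injective : ∀ {A B C : Set} {f : A → B} → Injective _≡_ _≡_ f → Injective _≡_ _≡_ (map₁ {C = C} f)
map₁-injective f-inj {a , c} {a′ , c′} e with f-inj (,-injectiveˡ e) | ,-injectiveʳ e
... | refl | refl = refl

map₂-injective : ∀ {A B C : Set} {f : B → C} → Injective _≡_ _≡_ f → Injective _≡_ _≡_ (map₂ {A = A} f)
map₂-injective f-inj {inj₁ a} {inj₁ .a} refl = refl
map₂-injective f-inj {inj₂ b} {inj₂ b′} e = cong inj₂ (f-inj (inj₂-injective e))

-- Wilson's construction with a point at infinity: give every point of the GDD weight d, fill each
-- inflated group together with ∞ by a design and each inflated block by a multipartite graph.
module Inflation {U : Set} (𝒢 : GDD U) (d : ℕ) where
  open GDD 𝒢

  Piece : Set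
  Piece = Group ⊎ Block

  Points : Piece → Set
  Points (inj₁ g) = ⊤ ⊎ (Member g × Fin d)
  Points (inj₂ b) = Fin (size b) × Fin d

  Adjacent : (j : Piece) → Points j → Points j → Set
  Adjacent (inj₁ g) = _≢_
  Adjacent (inj₂ b) = _≢_ on proj₁

  embed : (j : Piece) → Points j → ⊤ ⊎ (U × Fin d)
  embed (inj₁ g) = map₂ (map₁ (group g))
  embed (inj₂ b) = inj₂ ∘ map₁ (block b)

  embed-injective : ∀ j → Injective _≡_ _≡_ (embed j)
  embed-injective (inj₁ g) = map₂-injective (map₁-injective (group-injective g))
  embed-injective (inj₂ b) = map₁-injective (block-injective b) ∘ inj₂-injective

  preserves : ∀ j {a b} → Adjacent j a b → embed j a ≢ embed j b
  preserves (inj₁ g) a≢b = a≢b ∘ embed-injective (inj₁ g)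
  preserves (inj₂ b) p≢q = p≢q ∘ block-injective b ∘ ,-injectiveˡ ∘ inj₂-injective

  covers : ∀ {u v} → u ≢ v → Image Adjacent embed u v
  covers {inj₁ tt} {inj₁ tt} ∞≢∞ = ⊥-elim (∞≢∞ refl)
  covers {inj₁ tt} {inj₂ (v , y)} _ with grouped v
  ... | g , w , refl = inj₁ g , inj₁ tt , inj₂ (w , y) , (λ ()) , refl , refl
  covers {inj₂ (u , x)} {inj₁ tt} _ with grouped u
  ... | g , w , refl = inj₁ g , inj₂ (w , x) , inj₁ tt , (λ ()) , refl , refl
  covers {inj₂ (u , x)} {inj₂ (v , y)} ux≢vy with ≡-dec u v
  ... | yes refl with grouped u
  ...   | g , w , refl = inj₁ g , inj₂ (w , x) , inj₂ (w , y) , ux≢vy ∘ cong (embed (inj₁ g)) , refl , refl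
  covers {inj₂ (u , x)} {inj₂ (v , y)} ux≢vy | no u≢v with joined u≢v
  ... | inj₁ (g , w , w′ , _ , refl , refl) =
    inj₁ g , inj₂ (w , x) , inj₂ (w′ , y) , ux≢vy ∘ cong (embed (inj₁ g)) , refl , refl
  ... | inj₂ (b , p , q , p≢q , refl , refl) = inj₂ b , (p , x) , (q , y) , p≢q , refl , refl

  infinity-or-same-group : ∀ {g g′} (a : Points (inj₁ g)) (a′ : Points (inj₁ g′)) →
    embed (inj₁ g) a ≡ embed (inj₁ g′) a′ → a ≡ inj₁ tt ⊎ g ≡ g′
  infinity-or-same-group (inj₁ tt) _ _ = inj₁ refl
  infinity-or-same-group (inj₂ _) (inj₂ _) e = inj₂ (groups-disjoint (,-injectiveˡ (inj₂-injective e)))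

  disjoint : EdgeDisjoint Adjacent embed
  disjoint {inj₁ g} {inj₁ g′} {a} {b} {a′} {b′} a≢b _ e e′
    with infinity-or-same-group a a′ e | infinity-or-same-group b b′ e′
  ... | inj₂ refl | _         = refl
  ... | inj₁ _    | inj₂ refl = refl
  ... | inj₁ refl | inj₁ refl = ⊥-elim (a≢b refl)
  disjoint {inj₁ g} {inj₂ b} {inj₂ (w , _)} {inj₂ (w′ , _)} {p , _} {q , _} _ p≢q e e′ =
    ⊥-elim (group-block-meet p≢q (,-injectiveˡ (inj₂-injective e)) (,-injectiveˡ (inj₂-injective e′)))
  disjoint {inj₂ b} {inj₁ g} {p , _} {q , _} {inj₂ (w , _)} {inj₂ (w′ , _)} p≢q _ e e′ =
    ⊥-elim (group-block-meet p≢q (,-injectiveˡ (inj₂-injective (sym e))) (,-injectiveˡ (inj₂-injective (sym e′))))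
  disjoint {inj₂ b} {inj₂ b′} p≢q p′≢q′ e e′ =
    cong inj₂ (blocks-disjoint p≢q p′≢q′ (,-injectiveˡ (inj₂-injective e)) (,-injectiveˡ (inj₂-injective e′)))

  partition : EdgePartition Piece Points Adjacent _≢_
  partition = record
    { finite    = finite-⊎ groups-finite blocks-finite
    ; ψ         = embed
    ; injective = embed-injective
    ; preserves = preserves
    ; covers    = covers
    ; disjoint  = disjoint
    }

  inflate : ∀ {G} → (∀ g → Decomp G (⊤ ⊎ (Member g × Fin d)) _≢_) →
            (∀ b → Decomp G (Fin (size b) × Fin d) (_≢_ on proj₁)) → Decomp G (⊤ ⊎ (U × Fin d)) _≢_
  inflate {G} groups blocks = glue {G} partition pieces
    where
    pieces : ∀ j → Decomp G (Points j) (Adjacent j)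
    pieces (inj₁ g) = groups g
    pieces (inj₂ b) = blocks b

injective⇒surjective : ∀ {n} (f : Fin n → Fin n) → Injective _≡_ _≡_ f → ∀ y → ∃ λ x → f x ≡ y
injective⇒surjective {suc n} f f-inj y with any? (λ x → f x ≟ y)
... | yes hit = hit
... | no miss = ⊥-elim (1+n≰n (injective⇒≤ {f = f′} f′-inj))
  where
  f′ : Fin (suc n) → Fin n
  f′ x = punchOut {i = y} (λ y≡fx → miss (x , sym y≡fx))
  f′-inj : Injective _≡_ _≡_ f′
  f′-inj = f-inj ∘ punchOut-injective {i = y} _ _

injective⇒surjective-↔ : ∀ {A : Set} {n} → Fin n ↔ A → (f : A → A) → Injective _≡_ _≡_ f → ∀ y → ∃ λ x → f x ≡ y
injective⇒surjective-↔ e f f-inj y with injective⇒surjective (from e ∘ f ∘ to e)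
  (↔-injective e ∘ f-inj ∘ ↔-injective (↔-sym e)) (from e y)
... | x , fx≡y = to e x , ↔-injective (↔-sym e) fx≡y

record OrthogonalArray (s : ℕ) : Set where
  field
    entry      : Fin s × Fin s → Fin 4 → Fin s
    separating : ∀ {p q} → p ≢ q → ∀ {x y} → entry x p ≡ entry y p → entry x q ≡ entry y q → x ≡ y

  -- Counting: separating makes x ↦ (entry x p , entry x q) an injection between sets of size s².
  covering : ∀ {p q} → p ≢ q → ∀ α β → Σ (Fin s × Fin s) λ x → entry x p ≡ α × entry x q ≡ β
  covering {p} {q} p≢q α β with injective⇒surjective-↔ *↔× (λ x → entry x p , entry x q)
    (λ e → separating p≢q (,-injectiveˡ e) (,-injectiveʳ e)) (α , β)
  ... | x , e = x , ,-injectiveˡ e , ,-injectiveʳ e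

module _ {s : ℕ} (𝒪 : OrthogonalArray s) where
  open OrthogonalArray 𝒪

  -- Each row x of the OA places a copy of K_{4×m} inside K_{4×ms}, with part p scaled by entry x p.
  private
    place : ∀ {m} → Fin s × Fin s → Fin 4 × Fin m → Fin 4 × (Fin m × Fin s)
    place x (p , a) = p , a , entry x p

    rows-partition : ∀ m → EdgePartition (Fin s × Fin s) (λ _ → Fin 4 × Fin m) (λ _ → _≢_ on proj₁) (_≢_ on proj₁)
    rows-partition m = record
      { finite    = s * s , *↔×
      ; ψ         = place
      ; injective = λ x e → cong₂ _,_ (,-injectiveˡ e) (,-injectiveˡ (,-injectiveʳ e))
      ; preserves = λ x p≢q → p≢q
      ; covers    = covers
      ; disjoint  = disjoint
      }
      where
      covers : ∀ {u v} → proj₁ u ≢ proj₁ v → Image {Y = λ _ → Fin 4 × Fin m} (λ _ → _≢_ on proj₁) place u v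
      covers {p , a , α} {q , b , β} p≢q with covering p≢q α β
      ... | x , refl , refl = x , (p , a) , (q , b) , p≢q , refl , refl
      disjoint : EdgeDisjoint {Y = λ _ → Fin 4 × Fin m} (λ _ → _≢_ on proj₁) place
      disjoint {a = p , _} {q , _} {p′ , _} {q′ , _} p≢q _ e e′ with ,-injectiveˡ e | ,-injectiveˡ e′
      ... | refl | refl = separating p≢q (,-injectiveʳ (,-injectiveʳ e)) (,-injectiveʳ (,-injectiveʳ e′))

  blowUp : ∀ {G m} → Decomp G (Fin 4 × Fin m) (_≢_ on proj₁) → Decomp G (Fin 4 × Fin (m * s)) (_≢_ on proj₁)
  blowUp {G} {m} D = transport {G} (↔-refl ×-↔ ↔-sym *↔×) (λ p≢q → p≢q) (λ p≢q → p≢q)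
    (glue {G} (rows-partition m) (λ _ → D))

module Odd (h : ℕ) where
  s : ℕ
  s = suc (h + h)

  infix 4 _≡ₘ_
  _≡ₘ_ : ℕ → ℕ → Set
  x ≡ₘ y = x % s ≡ y % s

  +-cong-mod : ∀ {x x′ y y′} → x ≡ₘ x′ → y ≡ₘ y′ → x + y ≡ₘ x′ + y′
  +-cong-mod {x} {x′} {y} {y′} ex ey = begin
    (x + y) % s              ≡⟨ %-distribˡ-+ x y s ⟩
    (x % s + y % s) % s      ≡⟨ cong₂ (λ a b → (a + b) % s) ex ey ⟩
    (x′ % s + y′ % s) % s    ≡⟨ %-distribˡ-+ x′ y′ s ⟨
    (x′ + y′) % s            ∎
    where open ≡-Reasoning

  *-congˡ-mod : ∀ {x y} k → x ≡ₘ y → k * x ≡ₘ k * y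
  *-congˡ-mod {x} {y} k e = begin
    (k * x) % s              ≡⟨ %-distribˡ-* k x s ⟩
    (k % s * (x % s)) % s    ≡⟨ cong (λ z → (k % s * z) % s) e ⟩
    (k % s * (y % s)) % s    ≡⟨ %-distribˡ-* k y s ⟨
    (k * y) % s              ∎
    where open ≡-Reasoning

  -- Adding (s - 1) · a cancels a.
  +-cancelˡ-mod : ∀ a {x y} → a + x ≡ₘ a + y → x ≡ₘ y
  +-cancelˡ-mod a {x} {y} e = begin
    x % s                          ≡⟨ [m+kn]%n≡m%n x a s ⟨
    (x + a * s) % s                ≡⟨ cong (_% s) (shift h a x) ⟩
    (a + x + (h + h) * a) % s      ≡⟨ +-cong-mod {a + x} {a + y} {(h + h) * a} e refl ⟩
    (a + y + (h + h) * a) % s      ≡⟨ cong (_% s) (shift h a y) ⟨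
    (y + a * s) % s                ≡⟨ [m+kn]%n≡m%n y a s ⟩
    y % s                          ∎
    where
    open ≡-Reasoning
    shift : ∀ h a x → x + a * suc (h + h) ≡ a + x + (h + h) * a
    shift = solve-∀

  -- Multiplying by h + 1 halves.
  double-cancel-mod : ∀ {a b} → a + a ≡ₘ b + b → a ≡ₘ b
  double-cancel-mod {a} {b} e = begin
    a % s                          ≡⟨ [m+kn]%n≡m%n a a s ⟨
    (a + a * s) % s                ≡⟨ cong (_% s) (halve h a) ⟩
    (suc h * (a + a)) % s          ≡⟨ *-congˡ-mod {a + a} {b + b} (suc h) e ⟩
    (suc h * (b + b)) % s          ≡⟨ cong (_% s) (halve h b) ⟨
    (b + b * s) % s                ≡⟨ [m+kn]%n≡m%n b b s ⟩
    b % s                          ∎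
    where
    open ≡-Reasoning
    halve : ∀ h a → a + a * suc (h + h) ≡ suc h * (a + a)
    halve = solve-∀

  infixl 6 _⊕_
  _⊕_ : Fin s → Fin s → Fin s
  a ⊕ b = (toℕ a + toℕ b) mod s

  toℕ-⊕ : ∀ a b → toℕ (a ⊕ b) ≡ (toℕ a + toℕ b) % s
  toℕ-⊕ a b = toℕ-fromℕ< _

  toℕ-mod : ∀ (a : Fin s) → toℕ a % s ≡ toℕ a
  toℕ-mod a = m<n⇒m%n≡m (toℕ<n a)

  ≡-mod⇒≡ : ∀ {a b : Fin s} → toℕ a ≡ₘ toℕ b → a ≡ b
  ≡-mod⇒≡ {a} {b} e = toℕ-injective (trans (sym (toℕ-mod a)) (trans e (toℕ-mod b)))

  ⊕-comm : ∀ a b → a ⊕ b ≡ b ⊕ a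
  ⊕-comm a b = cong (_mod s) (+-comm (toℕ a) (toℕ b))

  toℕ-⊕-mod : ∀ a b → toℕ (a ⊕ b) ≡ₘ toℕ a + toℕ b
  toℕ-⊕-mod a b = trans (toℕ-mod (a ⊕ b)) (toℕ-⊕ a b)

  ⊕-assoc : ∀ a b c → a ⊕ b ⊕ c ≡ a ⊕ (b ⊕ c)
  ⊕-assoc a b c = ≡-mod⇒≡ (begin
    toℕ (a ⊕ b ⊕ c) % s
      ≡⟨ toℕ-⊕-mod (a ⊕ b) c ⟩
    (toℕ (a ⊕ b) + toℕ c) % s
      ≡⟨ +-cong-mod {toℕ (a ⊕ b)} {toℕ a + toℕ b} {toℕ c} (toℕ-⊕-mod a b) refl ⟩
    (toℕ a + toℕ b + toℕ c) % s
      ≡⟨ cong (_% s) (+-assoc (toℕ a) (toℕ b) (toℕ c)) ⟩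
    (toℕ a + (toℕ b + toℕ c)) % s
      ≡⟨ +-cong-mod {toℕ a} {toℕ a} {toℕ (b ⊕ c)} {toℕ b + toℕ c} refl (toℕ-⊕-mod b c) ⟨
    (toℕ a + toℕ (b ⊕ c)) % s
      ≡⟨ toℕ-⊕-mod a (b ⊕ c) ⟨
    toℕ (a ⊕ (b ⊕ c)) % s
      ∎)
    where open ≡-Reasoning

  ⊕-cancelˡ : ∀ a {b c} → a ⊕ b ≡ a ⊕ c → b ≡ c
  ⊕-cancelˡ a {b} {c} e = ≡-mod⇒≡ (+-cancelˡ-mod (toℕ a)
    (trans (sym (toℕ-⊕-mod a b)) (trans (cong (λ z → toℕ z % s) e) (toℕ-⊕-mod a c))))

  ⊕-cancelʳ : ∀ {a b} c → a ⊕ c ≡ b ⊕ c → a ≡ b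
  ⊕-cancelʳ {a} {b} c e = ⊕-cancelˡ c (trans (⊕-comm c a) (trans e (⊕-comm b c)))

  ⊕-double-injective : ∀ {a b} → a ⊕ a ≡ b ⊕ b → a ≡ b
  ⊕-double-injective {a} {b} e = ≡-mod⇒≡ (double-cancel-mod {toℕ a} {toℕ b}
    (trans (sym (toℕ-⊕-mod a a)) (trans (cong (λ z → toℕ z % s) e) (toℕ-⊕-mod b b))))

module CyclicOA (h : ℕ) where
  open Odd h

  entry : Fin s × Fin s → Fin 4 → Fin s
  entry (δ , a) zero                   = a
  entry (δ , a) (suc zero)             = a ⊕ δ
  entry (δ , a) (suc (suc zero))       = a ⊕ (a ⊕ δ)
  entry (δ , a) (suc (suc (suc zero))) = δ

  Determine : Fin 4 → Fin 4 → Set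
  Determine p q = ∀ {x y} → entry x p ≡ entry y p → entry x q ≡ entry y q → x ≡ y

  determine-01 : Determine zero (suc zero)
  determine-01 {δ , a} {δ′ , .a} refl e = cong (_, a) (⊕-cancelˡ a {δ} {δ′} e)

  determine-02 : Determine zero (suc (suc zero))
  determine-02 {δ , a} {δ′ , .a} refl e = cong (_, a) (⊕-cancelˡ a {δ} {δ′} (⊕-cancelˡ a {a ⊕ δ} {a ⊕ δ′} e))

  determine-03 : Determine zero (suc (suc (suc zero)))
  determine-03 refl refl = refl

  determine-12 : Determine (suc zero) (suc (suc zero))
  determine-12 {δ , a} {δ′ , a′} e e′ with ⊕-cancelʳ {a} {a′} (a ⊕ δ) (trans e′ (cong (a′ ⊕_) (sym e)))
  ... | refl = determine-01 refl e

  determine-13 : Determine (suc zero) (suc (suc (suc zero)))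
  determine-13 {δ , a} {.δ , a′} e refl = cong (δ ,_) (⊕-cancelʳ {a} {a′} δ e)

  -- The only place where s must be odd: 2a + δ and δ determine a.
  determine-23 : Determine (suc (suc zero)) (suc (suc (suc zero)))
  determine-23 {δ , a} {.δ , a′} e refl = cong (δ ,_) (⊕-double-injective (⊕-cancelʳ {a ⊕ a} {a′ ⊕ a′} δ
    (trans (⊕-assoc a a δ) (trans e (sym (⊕-assoc a′ a′ δ))))))

  separating : ∀ {p q} → p ≢ q → Determine p q
  separating {zero}                 {zero}                 p≢p    = ⊥-elim (p≢p refl)
  separating {zero}                 {suc zero}             _      = determine-01
  separating {zero}                 {suc (suc zero)}       _      = determine-02
  separating {zero}                 {suc (suc (suc zero))} _      = determine-03
  separating {suc zero}             {zero}                 _ e e′ = determine-01 e′ e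
  separating {suc zero}             {suc zero}             p≢p    = ⊥-elim (p≢p refl)
  separating {suc zero}             {suc (suc zero)}       _      = determine-12
  separating {suc zero}             {suc (suc (suc zero))} _      = determine-13
  separating {suc (suc zero)}       {zero}                 _ e e′ = determine-02 e′ e
  separating {suc (suc zero)}       {suc zero}             _ e e′ = determine-12 e′ e
  separating {suc (suc zero)}       {suc (suc zero)}       p≢p    = ⊥-elim (p≢p refl)
  separating {suc (suc zero)}       {suc (suc (suc zero))} _      = determine-23
  separating {suc (suc (suc zero))} {zero}                 _ e e′ = determine-03 e′ e
  separating {suc (suc (suc zero))} {suc zero}             _ e e′ = determine-13 e′ e
  separating {suc (suc (suc zero))} {suc (suc zero)}       _ e e′ = determine-23 e′ e
  separating {suc (suc (suc zero))} {suc (suc (suc zero))} p≢p    = ⊥-elim (p≢p refl)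

  cyclicOA : OrthogonalArray s
  cyclicOA = record { entry = entry ; separating = separating }

↑ˡ≢↑ʳ : ∀ {m n} (i : Fin m) (j : Fin n) → i ↑ˡ n ≢ m ↑ʳ j
↑ˡ≢↑ʳ {m} {n} i j e with trans (sym (splitAt-↑ˡ m i n)) (trans (cong (splitAt m) e) (splitAt-↑ʳ m n j))
... | ()

-- Deleting w points from the last group of a TD(4, u + w) leaves a GDD of type (u + w)³ u¹ with
-- blocks of size 4 and 3. Normalising the last column to δ sorts the rows (δ , a) by block size.
module TruncatedTD (u w : ℕ) (𝒪 : OrthogonalArray (u + w))
  (last-column : ∀ δ a → OrthogonalArray.entry 𝒪 (δ , a) (fromℕ 3) ≡ δ) where
  open OrthogonalArray 𝒪

  s : ℕ
  s = u + w

  Point : Set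
  Point = (Fin 3 × Fin s) ⊎ Fin u

  toTD : Point → Fin 4 × Fin s
  toTD (inj₁ (p , α)) = inject₁ p , α
  toTD (inj₂ y)       = fromℕ 3 , y ↑ˡ w

  toTD-injective : ∀ {U V} → toTD U ≡ toTD V → U ≡ V
  toTD-injective {inj₁ (p , α)} {inj₁ (q , β)} e with inject₁-injective (,-injectiveˡ e) | ,-injectiveʳ e
  ... | refl | refl = refl
  toTD-injective {inj₁ (p , _)} {inj₂ _} e = ⊥-elim (fromℕ≢inject₁ (sym (,-injectiveˡ e)))
  toTD-injective {inj₂ _} {inj₁ (p , _)} e = ⊥-elim (fromℕ≢inject₁ (,-injectiveˡ e))
  toTD-injective {inj₂ y} {inj₂ y′} e = cong inj₂ (↑ˡ-injective w y y′ (,-injectiveʳ e))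

  Group : Set
  Group = Fin 3 ⊎ ⊤

  groupColumn : Group → Fin 4
  groupColumn (inj₁ p) = inject₁ p
  groupColumn (inj₂ _) = fromℕ 3

  Member : Group → Set
  Member (inj₁ _) = Fin s
  Member (inj₂ _) = Fin u

  group : (g : Group) → Member g → Point
  group (inj₁ p) α = inj₁ (p , α)
  group (inj₂ _) y = inj₂ y

  column-group : ∀ g w → proj₁ (toTD (group g w)) ≡ groupColumn g
  column-group (inj₁ p) _ = refl
  column-group (inj₂ _) _ = refl

  Block : Set
  Block = (Fin u × Fin s) ⊎ (Fin w × Fin s)

  rows↔ : Block ↔ (Fin s × Fin s)
  rows↔ = ↔-trans (↔-sym (×-distribʳ-⊎ 0ℓ (Fin s) (Fin u) (Fin w))) (↔-sym +↔⊎ ×-↔ ↔-refl)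

  row : Block → Fin s × Fin s
  row = to rows↔

  size : Block → ℕ
  size (inj₁ _) = 4
  size (inj₂ _) = 3

  column : (b : Block) → Fin (size b) → Fin 4
  column (inj₁ _) = id
  column (inj₂ _) = inject₁

  column-injective : ∀ b {p q} → column b p ≡ column b q → p ≡ q
  column-injective (inj₁ _) = id
  column-injective (inj₂ _) = inject₁-injective

  block : (b : Block) → Fin (size b) → Point
  block b@(inj₁ _)     zero                   = inj₁ (zero , entry (row b) zero)
  block b@(inj₁ _)     (suc zero)             = inj₁ (suc zero , entry (row b) (suc zero))
  block b@(inj₁ _)     (suc (suc zero))       = inj₁ (suc (suc zero) , entry (row b) (suc (suc zero)))
  block   (inj₁ (y , _)) (suc (suc (suc zero))) = inj₂ y
  block b@(inj₂ _)     p                      = inj₁ (p , entry (row b) (inject₁ p))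

  toTD-block : ∀ b p → toTD (block b p) ≡ (column b p , entry (row b) (column b p))
  toTD-block (inj₁ _)       zero                   = refl
  toTD-block (inj₁ _)       (suc zero)             = refl
  toTD-block (inj₁ _)       (suc (suc zero))       = refl
  toTD-block (inj₁ (y , a)) (suc (suc (suc zero))) = cong (fromℕ 3 ,_) (sym (last-column (y ↑ˡ w) a))
  toTD-block (inj₂ _)       p                      = refl

  column-block : ∀ b p → proj₁ (toTD (block b p)) ≡ column b p
  column-block b p = cong proj₁ (toTD-block b p)

  block-injective : ∀ b {p q} → block b p ≡ block b q → p ≡ q
  block-injective b {p} {q} e =
    column-injective b (trans (sym (column-block b p)) (trans (cong (proj₁ ∘ toTD) e) (column-block b q)))

  OnRow : Block → Point → Set
  OnRow b V = proj₂ (toTD V) ≡ entry (row b) (proj₁ (toTD V))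

  on-row⇒column : ∀ b V → OnRow b V → Σ (Fin (size b)) λ p → column b p ≡ proj₁ (toTD V)
  on-row⇒column (inj₁ _)       V              _ = proj₁ (toTD V) , refl
  on-row⇒column (inj₂ _)       (inj₁ (p , _)) _ = p , refl
  on-row⇒column (inj₂ (z , a)) (inj₂ y)       e = ⊥-elim (↑ˡ≢↑ʳ y z (trans e (last-column (u ↑ʳ z) a)))

  on-row⇒in-block : ∀ b V → OnRow b V → Σ (Fin (size b)) λ p → column b p ≡ proj₁ (toTD V) × block b p ≡ V
  on-row⇒in-block b V on-row with on-row⇒column b V on-row
  ... | p , cp =
    p , cp , toTD-injective (trans (toTD-block b p) (cong₂ _,_ cp (trans (cong (entry (row b)) cp) (sym on-row))))

  same-column⇒same-group : ∀ U V → proj₁ (toTD U) ≡ proj₁ (toTD V) → Image (λ _ _ _ → ⊤) group U V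
  same-column⇒same-group (inj₁ (p , α)) (inj₁ (q , β)) e with inject₁-injective e
  ... | refl = inj₁ p , α , β , tt , refl , refl
  same-column⇒same-group (inj₁ _)       (inj₂ _)       e = ⊥-elim (fromℕ≢inject₁ (sym e))
  same-column⇒same-group (inj₂ _)       (inj₁ _)       e = ⊥-elim (fromℕ≢inject₁ e)
  same-column⇒same-group (inj₂ y)       (inj₂ y′)      _ = inj₂ tt , y , y′ , tt , refl , refl

  joined : ∀ {U V} → U ≢ V → Image (λ _ _ _ → ⊤) group U V ⊎ Image (λ _ → _≢_) block U V
  joined {U} {V} _ with proj₁ (toTD U) ≟ proj₁ (toTD V)
  ... | yes P≡Q = inj₁ (same-column⇒same-group U V P≡Q)
  ... | no P≢Q with covering P≢Q (proj₂ (toTD U)) (proj₂ (toTD V))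
  ...   | x , eU , eV = inj₂ (b , proj₁ inU , proj₁ inV , p≢q , proj₂ (proj₂ inU) , proj₂ (proj₂ inV))
    where
    b = from rows↔ x
    on-row : ∀ W → entry x (proj₁ (toTD W)) ≡ proj₂ (toTD W) → OnRow b W
    on-row _ e = trans (sym e) (cong (λ y → entry y _) (sym (strictlyInverseˡ rows↔ x)))
    inU = on-row⇒in-block b U (on-row U eU)
    inV = on-row⇒in-block b V (on-row V eV)
    p≢q : proj₁ inU ≢ proj₁ inV
    p≢q p≡q = P≢Q (trans (sym (proj₁ (proj₂ inU))) (trans (cong (column b) p≡q) (proj₁ (proj₂ inV))))

  groups-disjoint : ∀ {g g′ w w′} → group g w ≡ group g′ w′ → g ≡ g′
  groups-disjoint {inj₁ _} {inj₁ _} e = cong inj₁ (,-injectiveˡ (inj₁-injective e))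
  groups-disjoint {inj₂ _} {inj₂ _} _ = refl

  group-block-meet : ∀ {g b w w′ p q} → p ≢ q → group g w ≡ block b p → group g w′ ≡ block b q → ⊥
  group-block-meet {g} {b} {w} {w′} {p} {q} p≢q e e′ =
    p≢q (column-injective b (trans (in-group p w e) (sym (in-group q w′ e′))))
    where
    in-group : ∀ r v → group g v ≡ block b r → column b r ≡ groupColumn g
    in-group r v e = trans (sym (column-block b r)) (trans (cong (proj₁ ∘ toTD) (sym e)) (column-group g v))

  same-entry : ∀ {x y P P′} → (P , entry x P) ≡ (P′ , entry y P′) → entry x P ≡ entry y P
  same-entry e with ,-injectiveˡ e
  ... | refl = ,-injectiveʳ e

  blocks-disjoint : EdgeDisjoint (λ _ → _≢_) block
  blocks-disjoint {b} {b′} {p} {q} {p′} {q′} p≢q _ e e′ = ↔-injective rows↔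
    (separating (p≢q ∘ column-injective b) (same-entry (on-TD e)) (same-entry (on-TD e′)))
    where
    on-TD : ∀ {r r′} → block b r ≡ block b′ r′ →
            (column b r , entry (row b) (column b r)) ≡ (column b′ r′ , entry (row b′) (column b′ r′))
    on-TD {r} {r′} e = trans (sym (toTD-block b r)) (trans (cong toTD e) (toTD-block b′ r′))

  gdd : GDD Point
  gdd = record
    { ≡-dec           = Sum.≡-dec (Product.≡-dec _≟_ _≟_) _≟_
    ; Group           = Group
    ; groups-finite   = finite-⊎ (finite-Fin 3) (1 , 1↔⊤)
    ; Member          = Member
    ; group           = group
    ; group-injective = λ { (inj₁ _) → ,-injectiveʳ ∘ inj₁-injective ; (inj₂ _) → inj₂-injective }
    ; Block           = Block
    ; blocks-finite   = finite-↔ (finite-Fin (s * s)) (↔-trans *↔× (↔-sym rows↔))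
    ; size            = size
    ; block           = block
    ; block-injective = block-injective
    ; grouped         = λ { (inj₁ (p , α)) → inj₁ p , α , refl ; (inj₂ y) → inj₂ tt , y , refl }
    ; joined          = joined
    ; groups-disjoint = groups-disjoint
    ; group-block-meet = group-block-meet
    ; blocks-disjoint = blocks-disjoint
    }

-- The owner table names the group or block (block b encoded as nG + b) containing each pair;
-- as owner is a function, uniqueness reduces to every group and block owning its own pairs.
module Tabulated {N nG k nB c : ℕ}
  (groupTable : Vec (Vec (Fin N) k) nG) (blockTable : Vec (Vec (Fin N) c) nB)
  (ownerTable : Vec (Vec (Fin (nG + nB)) N) N) where

  group : Fin nG → Fin k → Fin N
  group g = lookup (lookup groupTable g)

  block : Fin nB → Fin c → Fin N
  block b = lookup (lookup blockTable b)

  owner : Fin N → Fin N → Fin nG ⊎ Fin nB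
  owner U V = splitAt nG (lookup (lookup ownerTable U) V)

  Holds : Fin nG ⊎ Fin nB → Fin N → Fin N → Set
  Holds (inj₁ g) U V = Σ (Fin k) λ i → Σ (Fin k) λ j → group g i ≡ U × group g j ≡ V
  Holds (inj₂ b) U V = Σ (Fin c) λ p → Σ (Fin c) λ q → p ≢ q × block b p ≡ U × block b q ≡ V

  holds? : ∀ o U V → Dec (Holds o U V)
  holds? (inj₁ g) U V = any? λ i → any? λ j → (group g i ≟ U) ×-dec (group g j ≟ V)
  holds? (inj₂ b) U V = any? λ p → any? λ q → ¬? (p ≟ q) ×-dec (block b p ≟ U) ×-dec (block b q ≟ V)

  Valid : Set
  Valid = (∀ g i j → group g i ≡ group g j → i ≡ j)
        × (∀ b p q → block b p ≡ block b q → p ≡ q)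
        × (∀ U → Σ (Fin nG) λ g → Σ (Fin k) λ i → group g i ≡ U)
        × (∀ U V → U ≢ V → Holds (owner U V) U V)
        × (∀ g i j → owner (group g i) (group g j) ≡ inj₁ g)
        × (∀ b p q → p ≢ q → owner (block b p) (block b q) ≡ inj₂ b)

  valid? : Dec Valid
  valid? = (all? λ g → all? λ i → all? λ j → (group g i ≟ group g j) →-dec (i ≟ j))
    ×-dec (all? λ b → all? λ p → all? λ q → (block b p ≟ block b q) →-dec (p ≟ q))
    ×-dec (all? λ U → any? λ g → any? λ i → group g i ≟ U)
    ×-dec (all? λ U → all? λ V → ¬? (U ≟ V) →-dec holds? (owner U V) U V)
    ×-dec (all? λ g → all? λ i → all? λ j → Sum.≡-dec _≟_ _≟_ (owner (group g i) (group g j)) (inj₁ g))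
    ×-dec (all? λ b → all? λ p → all? λ q →
             ¬? (p ≟ q) →-dec Sum.≡-dec _≟_ _≟_ (owner (block b p) (block b q)) (inj₂ b))

  valid⇒GDD : Valid → GDD (Fin N)
  valid⇒GDD (group-inj , block-inj , grouped , holds , group-owns , block-owns) = record
    { ≡-dec           = _≟_
    ; Group           = Fin nG
    ; groups-finite   = finite-Fin nG
    ; Member          = λ _ → Fin k
    ; group           = group
    ; group-injective = λ g → group-inj g _ _
    ; Block           = Fin nB
    ; blocks-finite   = finite-Fin nB
    ; size            = λ _ → c
    ; block           = block
    ; block-injective = λ b → block-inj b _ _
    ; grouped         = grouped
    ; joined          = joined
    ; groups-disjoint = λ {g} {g′} {i} {i′} e →
        inj₁-injective (trans (sym (group-owns g i i)) (trans (cong₂ owner e e) (group-owns g′ i′ i′)))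
    ; group-block-meet = λ {g} {b} {i} {i′} {p} {q} p≢q e e′ →
        inj₁≢inj₂ (trans (sym (group-owns g i i′)) (trans (cong₂ owner e e′) (block-owns b p q p≢q)))
    ; blocks-disjoint = λ {b} {b′} {p} {q} {p′} {q′} p≢q p′≢q′ e e′ →
        inj₂-injective (trans (sym (block-owns b p q p≢q)) (trans (cong₂ owner e e′) (block-owns b′ p′ q′ p′≢q′)))
    }
    where
    inj₁≢inj₂ : ∀ {A B : Set} {a : A} {b : B} → inj₁ a ≢ inj₂ b
    inj₁≢inj₂ ()
    joined : ∀ {U V} → U ≢ V → Image (λ _ _ _ → ⊤) group U V ⊎ Image (λ _ → _≢_) block U V
    joined {U} {V} U≢V with owner U V | holds U V U≢V
    ... | inj₁ g | i , j , eU , eV       = inj₁ (g , i , j , tt , eU , eV)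
    ... | inj₂ b | p , q , p≢q , eU , eV = inj₂ (b , p , q , p≢q , eU , eV)

  gdd : True valid? → GDD (Fin N)
  gdd valid = valid⇒GDD (toWitness {a? = valid?} valid)

-- GDDs of types 3⁵ (blocks of size 4) and 2³, 1⁷, 2⁴, 1¹³, 2⁷ (blocks of size 3).
module SmallGDDs where
  open import Agda.Builtin.FromNat using (Number; fromNat)
  import Data.Fin.Literals
  import Data.Nat.Literals

  instance
    ℕ-number : Number ℕ
    ℕ-number = Data.Nat.Literals.number
    Fin-number : ∀ {n} → Number (Fin n)
    Fin-number {n} = Data.Fin.Literals.number n

  gdd₁₅ : GDD (Fin 15)
  gdd₁₅ = Tabulated.gdd
    ((6 ∷ 8 ∷ 13 ∷ []) ∷ (0 ∷ 1 ∷ 2 ∷ []) ∷ (4 ∷ 9 ∷ 14 ∷ []) ∷ (5 ∷ 10 ∷ 12 ∷ []) ∷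
     (3 ∷ 7 ∷ 11 ∷ []) ∷ [])
    ((0 ∷ 6 ∷ 9 ∷ 11 ∷ []) ∷ (2 ∷ 6 ∷ 10 ∷ 14 ∷ []) ∷ (0 ∷ 4 ∷ 8 ∷ 12 ∷ []) ∷ (1 ∷ 3 ∷ 8 ∷ 14 ∷ []) ∷
     (2 ∷ 4 ∷ 7 ∷ 13 ∷ []) ∷ (2 ∷ 5 ∷ 8 ∷ 11 ∷ []) ∷ (0 ∷ 5 ∷ 7 ∷ 14 ∷ []) ∷ (1 ∷ 6 ∷ 7 ∷ 12 ∷ []) ∷
     (3 ∷ 4 ∷ 5 ∷ 6 ∷ []) ∷ (1 ∷ 4 ∷ 10 ∷ 11 ∷ []) ∷ (1 ∷ 5 ∷ 9 ∷ 13 ∷ []) ∷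
     (11 ∷ 12 ∷ 13 ∷ 14 ∷ []) ∷ (7 ∷ 8 ∷ 9 ∷ 10 ∷ []) ∷ (2 ∷ 3 ∷ 9 ∷ 12 ∷ []) ∷
     (0 ∷ 3 ∷ 10 ∷ 13 ∷ []) ∷ [])
    ((1 ∷ 1 ∷ 1 ∷ 19 ∷ 7 ∷ 11 ∷ 5 ∷ 11 ∷ 7 ∷ 5 ∷ 19 ∷ 5 ∷ 7 ∷ 19 ∷ 11 ∷ []) ∷
     (1 ∷ 1 ∷ 1 ∷ 8 ∷ 14 ∷ 15 ∷ 12 ∷ 12 ∷ 8 ∷ 15 ∷ 14 ∷ 14 ∷ 12 ∷ 15 ∷ 8 ∷ []) ∷
     (1 ∷ 1 ∷ 1 ∷ 18 ∷ 9 ∷ 10 ∷ 6 ∷ 9 ∷ 10 ∷ 18 ∷ 6 ∷ 10 ∷ 18 ∷ 9 ∷ 6 ∷ []) ∷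
     (19 ∷ 8 ∷ 18 ∷ 4 ∷ 13 ∷ 13 ∷ 13 ∷ 4 ∷ 8 ∷ 18 ∷ 19 ∷ 4 ∷ 18 ∷ 19 ∷ 8 ∷ []) ∷
     (7 ∷ 14 ∷ 9 ∷ 13 ∷ 2 ∷ 13 ∷ 13 ∷ 9 ∷ 7 ∷ 2 ∷ 14 ∷ 14 ∷ 7 ∷ 9 ∷ 2 ∷ []) ∷
     (11 ∷ 15 ∷ 10 ∷ 13 ∷ 13 ∷ 3 ∷ 13 ∷ 11 ∷ 10 ∷ 15 ∷ 3 ∷ 10 ∷ 3 ∷ 15 ∷ 11 ∷ []) ∷
     (5 ∷ 12 ∷ 6 ∷ 13 ∷ 13 ∷ 13 ∷ 0 ∷ 12 ∷ 0 ∷ 5 ∷ 6 ∷ 5 ∷ 12 ∷ 0 ∷ 6 ∷ []) ∷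
     (11 ∷ 12 ∷ 9 ∷ 4 ∷ 9 ∷ 11 ∷ 12 ∷ 4 ∷ 17 ∷ 17 ∷ 17 ∷ 4 ∷ 12 ∷ 9 ∷ 11 ∷ []) ∷
     (7 ∷ 8 ∷ 10 ∷ 8 ∷ 7 ∷ 10 ∷ 0 ∷ 17 ∷ 0 ∷ 17 ∷ 17 ∷ 10 ∷ 7 ∷ 0 ∷ 8 ∷ []) ∷
     (5 ∷ 15 ∷ 18 ∷ 18 ∷ 2 ∷ 15 ∷ 5 ∷ 17 ∷ 17 ∷ 2 ∷ 17 ∷ 5 ∷ 18 ∷ 15 ∷ 2 ∷ []) ∷
     (19 ∷ 14 ∷ 6 ∷ 19 ∷ 14 ∷ 3 ∷ 6 ∷ 17 ∷ 17 ∷ 17 ∷ 3 ∷ 14 ∷ 3 ∷ 19 ∷ 6 ∷ []) ∷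
     (5 ∷ 14 ∷ 10 ∷ 4 ∷ 14 ∷ 10 ∷ 5 ∷ 4 ∷ 10 ∷ 5 ∷ 14 ∷ 4 ∷ 16 ∷ 16 ∷ 16 ∷ []) ∷
     (7 ∷ 12 ∷ 18 ∷ 18 ∷ 7 ∷ 3 ∷ 12 ∷ 12 ∷ 7 ∷ 18 ∷ 3 ∷ 16 ∷ 3 ∷ 16 ∷ 16 ∷ []) ∷
     (19 ∷ 15 ∷ 9 ∷ 19 ∷ 9 ∷ 15 ∷ 0 ∷ 9 ∷ 0 ∷ 15 ∷ 19 ∷ 16 ∷ 16 ∷ 0 ∷ 16 ∷ []) ∷
     (11 ∷ 8 ∷ 6 ∷ 8 ∷ 2 ∷ 11 ∷ 6 ∷ 11 ∷ 8 ∷ 2 ∷ 6 ∷ 16 ∷ 16 ∷ 16 ∷ 2 ∷ []) ∷ [])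
    tt

  gdd₆ : GDD (Fin 6)
  gdd₆ = Tabulated.gdd
    ((0 ∷ 1 ∷ []) ∷ (2 ∷ 3 ∷ []) ∷ (4 ∷ 5 ∷ []) ∷ [])
    ((0 ∷ 2 ∷ 4 ∷ []) ∷ (0 ∷ 3 ∷ 5 ∷ []) ∷ (1 ∷ 2 ∷ 5 ∷ []) ∷ (1 ∷ 3 ∷ 4 ∷ []) ∷ [])
    ((0 ∷ 0 ∷ 3 ∷ 4 ∷ 3 ∷ 4 ∷ []) ∷ (0 ∷ 0 ∷ 5 ∷ 6 ∷ 6 ∷ 5 ∷ []) ∷ (3 ∷ 5 ∷ 1 ∷ 1 ∷ 3 ∷ 5 ∷ []) ∷
     (4 ∷ 6 ∷ 1 ∷ 1 ∷ 6 ∷ 4 ∷ []) ∷ (3 ∷ 6 ∷ 3 ∷ 6 ∷ 2 ∷ 2 ∷ []) ∷ (4 ∷ 5 ∷ 5 ∷ 4 ∷ 2 ∷ 2 ∷ []) ∷ [])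
    tt

  gdd₇ : GDD (Fin 7)
  gdd₇ = Tabulated.gdd
    ((0 ∷ []) ∷ (1 ∷ []) ∷ (2 ∷ []) ∷ (3 ∷ []) ∷ (4 ∷ []) ∷ (5 ∷ []) ∷ (6 ∷ []) ∷ [])
    ((0 ∷ 1 ∷ 3 ∷ []) ∷ (1 ∷ 2 ∷ 4 ∷ []) ∷ (2 ∷ 3 ∷ 5 ∷ []) ∷ (3 ∷ 4 ∷ 6 ∷ []) ∷ (4 ∷ 5 ∷ 0 ∷ []) ∷
     (5 ∷ 6 ∷ 1 ∷ []) ∷ (6 ∷ 0 ∷ 2 ∷ []) ∷ [])
    ((0 ∷ 7 ∷ 13 ∷ 7 ∷ 11 ∷ 11 ∷ 13 ∷ []) ∷ (7 ∷ 1 ∷ 8 ∷ 7 ∷ 8 ∷ 12 ∷ 12 ∷ []) ∷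
     (13 ∷ 8 ∷ 2 ∷ 9 ∷ 8 ∷ 9 ∷ 13 ∷ []) ∷ (7 ∷ 7 ∷ 9 ∷ 3 ∷ 10 ∷ 9 ∷ 10 ∷ []) ∷
     (11 ∷ 8 ∷ 8 ∷ 10 ∷ 4 ∷ 11 ∷ 10 ∷ []) ∷ (11 ∷ 12 ∷ 9 ∷ 9 ∷ 11 ∷ 5 ∷ 12 ∷ []) ∷
     (13 ∷ 12 ∷ 13 ∷ 10 ∷ 10 ∷ 12 ∷ 6 ∷ []) ∷ [])
    tt

  gdd₈ : GDD (Fin 8)
  gdd₈ = Tabulated.gdd
    ((0 ∷ 1 ∷ []) ∷ (2 ∷ 3 ∷ []) ∷ (4 ∷ 5 ∷ []) ∷ (6 ∷ 7 ∷ []) ∷ [])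
    ((0 ∷ 3 ∷ 4 ∷ []) ∷ (0 ∷ 2 ∷ 7 ∷ []) ∷ (0 ∷ 5 ∷ 6 ∷ []) ∷ (1 ∷ 2 ∷ 5 ∷ []) ∷ (2 ∷ 4 ∷ 6 ∷ []) ∷
     (1 ∷ 4 ∷ 7 ∷ []) ∷ (3 ∷ 5 ∷ 7 ∷ []) ∷ (1 ∷ 3 ∷ 6 ∷ []) ∷ [])
    ((0 ∷ 0 ∷ 5 ∷ 4 ∷ 4 ∷ 6 ∷ 6 ∷ 5 ∷ []) ∷ (0 ∷ 0 ∷ 7 ∷ 11 ∷ 9 ∷ 7 ∷ 11 ∷ 9 ∷ []) ∷
     (5 ∷ 7 ∷ 1 ∷ 1 ∷ 8 ∷ 7 ∷ 8 ∷ 5 ∷ []) ∷ (4 ∷ 11 ∷ 1 ∷ 1 ∷ 4 ∷ 10 ∷ 11 ∷ 10 ∷ []) ∷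
     (4 ∷ 9 ∷ 8 ∷ 4 ∷ 2 ∷ 2 ∷ 8 ∷ 9 ∷ []) ∷ (6 ∷ 7 ∷ 7 ∷ 10 ∷ 2 ∷ 2 ∷ 6 ∷ 10 ∷ []) ∷
     (6 ∷ 11 ∷ 8 ∷ 11 ∷ 8 ∷ 6 ∷ 3 ∷ 3 ∷ []) ∷ (5 ∷ 9 ∷ 5 ∷ 10 ∷ 9 ∷ 10 ∷ 3 ∷ 3 ∷ []) ∷ [])
    tt

  gdd₁₃ : GDD (Fin 13)
  gdd₁₃ = Tabulated.gdd
    ((0 ∷ []) ∷ (1 ∷ []) ∷ (2 ∷ []) ∷ (3 ∷ []) ∷ (4 ∷ []) ∷ (5 ∷ []) ∷ (6 ∷ []) ∷ (7 ∷ []) ∷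
     (8 ∷ []) ∷ (9 ∷ []) ∷ (10 ∷ []) ∷ (11 ∷ []) ∷ (12 ∷ []) ∷ [])
    ((0 ∷ 1 ∷ 4 ∷ []) ∷ (0 ∷ 2 ∷ 7 ∷ []) ∷ (1 ∷ 2 ∷ 5 ∷ []) ∷ (1 ∷ 3 ∷ 8 ∷ []) ∷ (2 ∷ 3 ∷ 6 ∷ []) ∷
     (2 ∷ 4 ∷ 9 ∷ []) ∷ (3 ∷ 4 ∷ 7 ∷ []) ∷ (3 ∷ 5 ∷ 10 ∷ []) ∷ (4 ∷ 5 ∷ 8 ∷ []) ∷ (4 ∷ 6 ∷ 11 ∷ []) ∷
     (5 ∷ 6 ∷ 9 ∷ []) ∷ (5 ∷ 7 ∷ 12 ∷ []) ∷ (6 ∷ 7 ∷ 10 ∷ []) ∷ (6 ∷ 8 ∷ 0 ∷ []) ∷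
     (7 ∷ 8 ∷ 11 ∷ []) ∷ (7 ∷ 9 ∷ 1 ∷ []) ∷ (8 ∷ 9 ∷ 12 ∷ []) ∷ (8 ∷ 10 ∷ 2 ∷ []) ∷
     (9 ∷ 10 ∷ 0 ∷ []) ∷ (9 ∷ 11 ∷ 3 ∷ []) ∷ (10 ∷ 11 ∷ 1 ∷ []) ∷ (10 ∷ 12 ∷ 4 ∷ []) ∷
     (11 ∷ 12 ∷ 2 ∷ []) ∷ (11 ∷ 0 ∷ 5 ∷ []) ∷ (12 ∷ 0 ∷ 3 ∷ []) ∷ (12 ∷ 1 ∷ 6 ∷ []) ∷ [])
    ((0 ∷ 13 ∷ 14 ∷ 37 ∷ 13 ∷ 36 ∷ 26 ∷ 14 ∷ 26 ∷ 31 ∷ 31 ∷ 36 ∷ 37 ∷ []) ∷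
     (13 ∷ 1 ∷ 15 ∷ 16 ∷ 13 ∷ 15 ∷ 38 ∷ 28 ∷ 16 ∷ 28 ∷ 33 ∷ 33 ∷ 38 ∷ []) ∷
     (14 ∷ 15 ∷ 2 ∷ 17 ∷ 18 ∷ 15 ∷ 17 ∷ 14 ∷ 30 ∷ 18 ∷ 30 ∷ 35 ∷ 35 ∷ []) ∷
     (37 ∷ 16 ∷ 17 ∷ 3 ∷ 19 ∷ 20 ∷ 17 ∷ 19 ∷ 16 ∷ 32 ∷ 20 ∷ 32 ∷ 37 ∷ []) ∷
     (13 ∷ 13 ∷ 18 ∷ 19 ∷ 4 ∷ 21 ∷ 22 ∷ 19 ∷ 21 ∷ 18 ∷ 34 ∷ 22 ∷ 34 ∷ []) ∷
     (36 ∷ 15 ∷ 15 ∷ 20 ∷ 21 ∷ 5 ∷ 23 ∷ 24 ∷ 21 ∷ 23 ∷ 20 ∷ 36 ∷ 24 ∷ []) ∷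
     (26 ∷ 38 ∷ 17 ∷ 17 ∷ 22 ∷ 23 ∷ 6 ∷ 25 ∷ 26 ∷ 23 ∷ 25 ∷ 22 ∷ 38 ∷ []) ∷
     (14 ∷ 28 ∷ 14 ∷ 19 ∷ 19 ∷ 24 ∷ 25 ∷ 7 ∷ 27 ∷ 28 ∷ 25 ∷ 27 ∷ 24 ∷ []) ∷
     (26 ∷ 16 ∷ 30 ∷ 16 ∷ 21 ∷ 21 ∷ 26 ∷ 27 ∷ 8 ∷ 29 ∷ 30 ∷ 27 ∷ 29 ∷ []) ∷
     (31 ∷ 28 ∷ 18 ∷ 32 ∷ 18 ∷ 23 ∷ 23 ∷ 28 ∷ 29 ∷ 9 ∷ 31 ∷ 32 ∷ 29 ∷ []) ∷
     (31 ∷ 33 ∷ 30 ∷ 20 ∷ 34 ∷ 20 ∷ 25 ∷ 25 ∷ 30 ∷ 31 ∷ 10 ∷ 33 ∷ 34 ∷ []) ∷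
     (36 ∷ 33 ∷ 35 ∷ 32 ∷ 22 ∷ 36 ∷ 22 ∷ 27 ∷ 27 ∷ 32 ∷ 33 ∷ 11 ∷ 35 ∷ []) ∷
     (37 ∷ 38 ∷ 35 ∷ 37 ∷ 34 ∷ 24 ∷ 38 ∷ 24 ∷ 29 ∷ 29 ∷ 34 ∷ 35 ∷ 12 ∷ []) ∷ [])
    tt

  gdd₁₄ : GDD (Fin 14)
  gdd₁₄ = Tabulated.gdd
    ((4 ∷ 9 ∷ []) ∷ (5 ∷ 8 ∷ []) ∷ (3 ∷ 10 ∷ []) ∷ (0 ∷ 13 ∷ []) ∷ (6 ∷ 7 ∷ []) ∷ (1 ∷ 12 ∷ []) ∷
     (2 ∷ 11 ∷ []) ∷ [])
    ((2 ∷ 8 ∷ 9 ∷ []) ∷ (2 ∷ 4 ∷ 5 ∷ []) ∷ (1 ∷ 8 ∷ 10 ∷ []) ∷ (3 ∷ 8 ∷ 12 ∷ []) ∷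
     (3 ∷ 9 ∷ 13 ∷ []) ∷ (1 ∷ 4 ∷ 6 ∷ []) ∷ (6 ∷ 10 ∷ 11 ∷ []) ∷ (0 ∷ 3 ∷ 4 ∷ []) ∷
     (2 ∷ 3 ∷ 6 ∷ []) ∷ (6 ∷ 9 ∷ 12 ∷ []) ∷ (4 ∷ 8 ∷ 11 ∷ []) ∷ (6 ∷ 8 ∷ 13 ∷ []) ∷
     (0 ∷ 9 ∷ 10 ∷ []) ∷ (4 ∷ 7 ∷ 12 ∷ []) ∷ (5 ∷ 9 ∷ 11 ∷ []) ∷ (1 ∷ 11 ∷ 13 ∷ []) ∷
     (1 ∷ 7 ∷ 9 ∷ []) ∷ (0 ∷ 5 ∷ 6 ∷ []) ∷ (3 ∷ 7 ∷ 11 ∷ []) ∷ (5 ∷ 7 ∷ 13 ∷ []) ∷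
     (2 ∷ 12 ∷ 13 ∷ []) ∷ (4 ∷ 10 ∷ 13 ∷ []) ∷ (0 ∷ 1 ∷ 2 ∷ []) ∷ (0 ∷ 11 ∷ 12 ∷ []) ∷
     (5 ∷ 10 ∷ 12 ∷ []) ∷ (1 ∷ 3 ∷ 5 ∷ []) ∷ (0 ∷ 7 ∷ 8 ∷ []) ∷ (2 ∷ 7 ∷ 10 ∷ []) ∷ [])
    ((3 ∷ 29 ∷ 29 ∷ 14 ∷ 14 ∷ 24 ∷ 24 ∷ 33 ∷ 33 ∷ 19 ∷ 19 ∷ 30 ∷ 30 ∷ 3 ∷ []) ∷
     (29 ∷ 5 ∷ 29 ∷ 32 ∷ 12 ∷ 32 ∷ 12 ∷ 23 ∷ 9 ∷ 23 ∷ 9 ∷ 22 ∷ 5 ∷ 22 ∷ []) ∷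
     (29 ∷ 29 ∷ 6 ∷ 15 ∷ 8 ∷ 8 ∷ 15 ∷ 34 ∷ 7 ∷ 7 ∷ 34 ∷ 6 ∷ 27 ∷ 27 ∷ []) ∷
     (14 ∷ 32 ∷ 15 ∷ 2 ∷ 14 ∷ 32 ∷ 15 ∷ 25 ∷ 10 ∷ 11 ∷ 2 ∷ 25 ∷ 10 ∷ 11 ∷ []) ∷
     (14 ∷ 12 ∷ 8 ∷ 14 ∷ 0 ∷ 8 ∷ 12 ∷ 20 ∷ 17 ∷ 0 ∷ 28 ∷ 17 ∷ 20 ∷ 28 ∷ []) ∷
     (24 ∷ 32 ∷ 8 ∷ 32 ∷ 8 ∷ 1 ∷ 24 ∷ 26 ∷ 1 ∷ 21 ∷ 31 ∷ 21 ∷ 31 ∷ 26 ∷ []) ∷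
     (24 ∷ 12 ∷ 15 ∷ 15 ∷ 12 ∷ 24 ∷ 4 ∷ 4 ∷ 18 ∷ 16 ∷ 13 ∷ 13 ∷ 16 ∷ 18 ∷ []) ∷
     (33 ∷ 23 ∷ 34 ∷ 25 ∷ 20 ∷ 26 ∷ 4 ∷ 4 ∷ 33 ∷ 23 ∷ 34 ∷ 25 ∷ 20 ∷ 26 ∷ []) ∷
     (33 ∷ 9 ∷ 7 ∷ 10 ∷ 17 ∷ 1 ∷ 18 ∷ 33 ∷ 1 ∷ 7 ∷ 9 ∷ 17 ∷ 10 ∷ 18 ∷ []) ∷
     (19 ∷ 23 ∷ 7 ∷ 11 ∷ 0 ∷ 21 ∷ 16 ∷ 23 ∷ 7 ∷ 0 ∷ 19 ∷ 21 ∷ 16 ∷ 11 ∷ []) ∷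
     (19 ∷ 9 ∷ 34 ∷ 2 ∷ 28 ∷ 31 ∷ 13 ∷ 34 ∷ 9 ∷ 19 ∷ 2 ∷ 13 ∷ 31 ∷ 28 ∷ []) ∷
     (30 ∷ 22 ∷ 6 ∷ 25 ∷ 17 ∷ 21 ∷ 13 ∷ 25 ∷ 17 ∷ 21 ∷ 13 ∷ 6 ∷ 30 ∷ 22 ∷ []) ∷
     (30 ∷ 5 ∷ 27 ∷ 10 ∷ 20 ∷ 31 ∷ 16 ∷ 20 ∷ 10 ∷ 16 ∷ 31 ∷ 30 ∷ 5 ∷ 27 ∷ []) ∷
     (3 ∷ 22 ∷ 27 ∷ 11 ∷ 28 ∷ 26 ∷ 18 ∷ 26 ∷ 18 ∷ 11 ∷ 28 ∷ 22 ∷ 27 ∷ 3 ∷ []) ∷ [])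
    tt

complete-↔ : ∀ {G X Y} → X ↔ Y → Decomp G X _≢_ → Decomp G Y _≢_
complete-↔ {G} e = transport {G} e (λ u≢v → u≢v ∘ ↔-injective e) (λ u≢v → u≢v ∘ ↔-injective (↔-sym e))

pointed↔ : ∀ {A : Set} k d → A ↔ Fin k → (⊤ ⊎ (A × Fin d)) ↔ Fin (k * d + 1)
pointed↔ k d e = ↔-trans (⊎-comm _ _) (↔-trans (↔-trans (e ×-↔ ↔-refl) (↔-sym *↔×) ⊎-↔ ↔-sym 1↔⊤) (↔-sym +↔⊎))

design⇒pointed : ∀ {G k d} → Design G (k * d + 1) → Decomp G (⊤ ⊎ (Fin k × Fin d)) _≢_
design⇒pointed {G} {k} {d} = complete-↔ {G} (↔-sym (pointed↔ k d ↔-refl)) ∘ design⇒Decomp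

pointed⇒design : ∀ {G U N d} → U ↔ Fin N → Decomp G (⊤ ⊎ (U × Fin d)) _≢_ → Design G (N * d + 1)
pointed⇒design {G} {N = N} {d} e = Decomp⇒design ∘ complete-↔ {G} (pointed↔ N d e)

design-1 : ∀ {G} → Design G 1
design-1 = record { k = 0 ; copies = λ () ; covered = λ { zero zero () } ; unique = λ { _ _ (() , _) _ } }

GDD⇒design : ∀ {G U N d} (𝒢 : GDD U) → U ↔ Fin N →
  (∀ g → Decomp G (⊤ ⊎ (GDD.Member 𝒢 g × Fin d)) _≢_) →
  (∀ b → Decomp G (Fin (GDD.size 𝒢 b) × Fin d) (_≢_ on proj₁)) → Design G (N * d + 1)
GDD⇒design {G} {d = d} 𝒢 e groups blocks = pointed⇒design {G} e (Inflation.inflate 𝒢 d {G} groups blocks)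

module Construction (G : Graph) (m : ℕ)
  (design₁ : Design G (m * 3 + 1)) (design₂ : Design G (2 * (m * 3) + 1))
  (tripartite : Decomposition (K3part (m * 3)) G) (quadripartite : Decomposition (K4part m) G) where

  e : ℕ
  e = m * 3

  Order : ℕ → Set
  Order t = Design G (t * e + 1)

  K₃ₓₑ : Decomp G (Fin 3 × Fin e) (_≢_ on proj₁)
  K₃ₓₑ = multipartite⇒Decomp tripartite

  K₄ₓₘ : Decomp G (Fin 4 × Fin m) (_≢_ on proj₁)
  K₄ₓₘ = multipartite⇒Decomp quadripartite

  K₄ₓₑ : Decomp G (Fin 4 × Fin e) (_≢_ on proj₁)
  K₄ₓₑ = blowUp (CyclicOA.cyclicOA 1) {G} K₄ₓₘ

  order-1 : Order 1
  order-1 = subst (λ n → Design G (n + 1)) (sym (*-identityˡ e)) design₁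

  -- 5e = 15 (e / 3): the only order built from K₄ₓₘ directly.
  order-5 : Order 5
  order-5 = subst (λ n → Design G (n + 1)) (15m≡5e m)
    (GDD⇒design SmallGDDs.gdd₁₅ ↔-refl (λ _ → design⇒pointed design₁′) (λ _ → K₄ₓₘ))
    where
    design₁′ : Design G (3 * m + 1)
    design₁′ = subst (λ n → Design G (n + 1)) (*-comm m 3) design₁
    15m≡5e : ∀ m → 15 * m ≡ 5 * (m * 3)
    15m≡5e = solve-∀

  order-6 : Order 6
  order-6 = GDD⇒design SmallGDDs.gdd₆ ↔-refl (λ _ → design⇒pointed design₂) (λ _ → K₃ₓₑ)

  order-7 : Order 7
  order-7 = GDD⇒design SmallGDDs.gdd₇ ↔-refl (λ _ → design⇒pointed order-1) (λ _ → K₃ₓₑ)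

  order-8 : Order 8
  order-8 = GDD⇒design SmallGDDs.gdd₈ ↔-refl (λ _ → design⇒pointed design₂) (λ _ → K₃ₓₑ)

  order-13 : Order 13
  order-13 = GDD⇒design SmallGDDs.gdd₁₃ ↔-refl (λ _ → design⇒pointed order-1) (λ _ → K₃ₓₑ)

  order-14 : Order 14
  order-14 = GDD⇒design SmallGDDs.gdd₁₄ ↔-refl (λ _ → design⇒pointed design₂) (λ _ → K₃ₓₑ)

  truncation : ∀ h u w → suc (h + h) ≡ u + w → Order (u + w) → Order u → Order (3 * (u + w) + u)
  truncation h u w = fromTD (CyclicOA.cyclicOA h) (λ _ _ → refl)
    where
    fromTD : ∀ {s} (𝒪 : OrthogonalArray s) (last-column : ∀ δ a → OrthogonalArray.entry 𝒪 (δ , a) (fromℕ 3) ≡ δ)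
             → s ≡ u + w → Order (u + w) → Order u → Order (3 * (u + w) + u)
    fromTD 𝒪 last-column refl Dₛ Dᵤ = GDD⇒design (TruncatedTD.gdd u w 𝒪 last-column)
      (↔-sym (↔-trans +↔⊎ (*↔× ⊎-↔ ↔-refl))) groups blocks
      where
      groups : ∀ g → Decomp G (⊤ ⊎ (TruncatedTD.Member u w 𝒪 last-column g × Fin e)) _≢_
      groups (inj₁ _) = design⇒pointed Dₛ
      groups (inj₂ _) = design⇒pointed Dᵤ
      blocks : ∀ b → Decomp G (Fin (TruncatedTD.size u w 𝒪 last-column b) × Fin e) (_≢_ on proj₁)
      blocks (inj₁ _) = K₄ₓₑ
      blocks (inj₂ _) = K₃ₓₑ

  byTruncation : ∀ h u → u ≤ suc (h + h) → <-Rec Order (3 * suc (h + h) + u) → Order (3 * suc (h + h) + u)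
  byTruncation h u u≤s ih = subst (λ s → Order (3 * s + u)) u+w≡s
    (truncation h u w (sym u+w≡s) (subst Order (sym u+w≡s) (ih s<t)) (ih (≤-<-trans u≤s s<t)))
    where
    s = suc (h + h)
    w = s ∸ u
    u+w≡s : u + w ≡ s
    u+w≡s = m+[n∸m]≡n u≤s
    s<t : s < 3 * s + u
    s<t = <-≤-trans (m<m+n s (s≤s z≤n)) (m≤m+n (3 * s) u)

  step : ∀ t → <-Rec Order t → Order t
  step 0  _ = design-1
  step 1  _ = order-1
  step 2  _ = design₂
  step 3    = byTruncation 0 0 z≤n
  step 4    = byTruncation 0 1 (s≤s z≤n)
  step 5  _ = order-5
  step 6  _ = order-6
  step 7  _ = order-7
  step 8  _ = order-8
  step 9    = byTruncation 1 0 z≤n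
  step 10   = byTruncation 1 1 (s≤s z≤n)
  step 11   = byTruncation 1 2 (s≤s (s≤s z≤n))
  step 12   = byTruncation 1 3 (s≤s (s≤s (s≤s z≤n)))
  step 13 _ = order-13
  step 14 _ = order-14
  -- 15 + t = 3 (2n + 5) + r with n = t / 6 and r = t % 6 < 6 ≤ 2n + 5.
  step (suc (suc (suc (suc (suc (suc (suc (suc (suc (suc (suc (suc (suc (suc (suc t))))))))))))))) ih =
    subst Order shape (byTruncation (2 + n) r r≤s (subst (<-Rec Order) (sym shape) ih))
    where
    n = t / 6
    r = t % 6
    r≤s : r ≤ suc ((2 + n) + (2 + n))
    r≤s = ≤-trans (≤-pred (m%n<n t 6)) (s≤s (s≤s (s≤s (≤-trans (m≤m+n 2 n) (m≤n+m (2 + n) n)))))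
    shape : 3 * suc ((2 + n) + (2 + n)) + r ≡ 15 + t
    shape = trans (arith n r) (cong (15 +_) (sym (m≡m%n+[m/n]*n t 6)))
      where
      arith : ∀ n r → 3 * suc ((2 + n) + (2 + n)) + r ≡ 15 + (r + n * 6)
      arith = solve-∀

  design : ∀ t → Order t
  design = <-rec Order step

designs : ∀ {G e m} → e ≡ m * 3 → Design G (e + 1) → Design G (2 * e + 1) →
  Decomposition (K3part e) G → Decomposition (K4part (e / 3)) G → ∀ t → Design G (t * e + 1)
designs {G} {m = m} refl D₁ D₂ D₃ D₄ =
  Construction.design G m D₁ D₂ D₃ (subst (λ k → Decomposition (K4part k) G) (m*n/n≡m m 3) D₄)

proposition4 : (G : Graph) → 0 < edges G → 3 ∣ edges G →
    Design G (edges G + 1) → Design G (2 * edges G + 1) →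
    Decomposition (K3part (edges G)) G →
    Decomposition (K4part (edges G / 3)) G →
    ∀ (n t : ℕ) → n ≡ t * edges G + 1 → Design G n
proposition4 G _ (divides m e≡m*3) D₁ D₂ D₃ D₄ n t refl = designs {m = m} e≡m*3 D₁ D₂ D₃ D₄ t
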